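{- For every positive integer $n$, $$t(1,2,2,6;n)=\frac12\,N(1,1,4,6;\,8n+11)\qquad\text{and}\qquad t(1,1,8,12;2n)=\frac12\,N(1,1,8,12;\,16n+22).$$
   Context: For positive integers $a,b,c,d$ and an integer $n\ge 0$, $N(a,b,c,d;n)$ denotes the number of $(x,y,z,w)\in\mathbb Z^4$ with $n=ax^2+by^2+cz^2+dw^2$, and $t(a,b,c,d;n)$ denotes the number of $(x,y,z,w)\in\mathbb Z^4$ with $n=a\frac{x(x-1)}2+b\frac{y(y-1)}2+c\frac{z(z-1)}2+d\frac{w(w-1)}2$. -}

module Defs where

open import Data.Nat as ℕ using (ℕ; suc)
open import Data.Integer as ℤ using (ℤ; +_; _-_; _*_; _+_; -_)
open import Data.List using (List; []; _∷_; length; filter; map; concatMap)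
open import Data.Product using (_×_; _,_)
open import Relation.Binary.PropositionalEquality using (_≡_)
open import Data.Integer.Properties using () renaming (_≟_ to _≟ℤ_)

window : ℕ → List ℤ
window m = go (2 ℕ.+ 2 ℕ.* m)
  where
  go : ℕ → List ℤ
  go ℕ.zero = []
  go (suc k) = (+ k - + m) ∷ go k

box4 : ℕ → List (ℤ × ℤ × ℤ × ℤ)
box4 m = concatMap (λ x → concatMap (λ y → concatMap (λ z → map (λ w → (x , y , z , w))
           (window m)) (window m)) (window m)) (window m)

Q : ℕ → ℕ → ℕ → ℕ → ℤ × ℤ × ℤ × ℤ → ℤ
Q a b c d (x , y , z , w) = + a * (x * x) + + b * (y * y) + + c * (z * z) + + d * (w * w)

-- Twice the triangular form: a x(x-1) + b y(y-1) + c z(z-1) + d w(w-1).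
-- (n = Σ a x(x-1)/2  iff  2n = Σ a x(x-1), the latter being an integer identity.)
T2 : ℕ → ℕ → ℕ → ℕ → ℤ × ℤ × ℤ × ℤ → ℤ
T2 a b c d (x , y , z , w) =
  + a * (x * (x - + 1)) + + b * (y * (y - + 1)) + + c * (z * (z - + 1)) + + d * (w * (w - + 1))

-- For positive a,b,c,d every solution satisfies |x|,|y|,|z|,|w| ≤ n, so it lies
-- in the window [-n, n+1]⁴ and the count below is the full count.
N : ℕ → ℕ → ℕ → ℕ → ℕ → ℕ
N a b c d n = length (filter (λ v → Q a b c d v ≟ℤ + n) (box4 n))

-- t(a,b,c,d;n): number of (x,y,z,w) ∈ ℤ⁴ with
-- n = a x(x-1)/2 + b y(y-1)/2 + c z(z-1)/2 + d w(w-1)/2.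
-- For positive a,b,c,d every solution has x(x-1)/2 ≤ n, hence x ∈ [-n, n+1].
t : ℕ → ℕ → ℕ → ℕ → ℕ → ℕ
t a b c d n = length (filter (λ v → T2 a b c d v ≟ℤ + (2 ℕ.* n)) (box4 n))

-- Completing squares, (2x - 1)² = 4x(x - 1) + 1, turns a solution of
-- a x(x-1)/2 + b y(y-1)/2 + c z(z-1)/2 + d w(w-1)/2 = m into a representation of 8m + a + b + c + d
-- by a x² + b y² + c z² + d w² with all four coordinates odd, bijectively.
--
-- For (1,2,2,6) the identity 2(u² + v²) = (u + v)² + (u - v)² rewrites these as the representations
-- of 8n + 11 by x² + y² + 4z² + 6w² with x odd, y even and y/2 + z odd. Modulo 8, every
-- representation of 8n + 11 has exactly one of x, y odd, and when it is x, y/2 + z is odd; swapping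
-- x and y accounts for the other half.
--
-- For (1,1,8,12), every representation of 16n + 22 by x² + y² + 8z² + 12w² has x, y, w odd, and those
-- with z odd are the all-odd ones above. Write x = A + B and y = A - B, where A + B is odd; modulo 16,
-- half of the even one of A, B has the parity opposite to z. Exchanging the even one with 2z
-- therefore matches the representations with z odd bijectively with those with z even.
module Submission where

open import Defs

-- The development uses the integer _+_ and _*_ unqualified, while the statement of theorem2p13 uses
-- those of ℕ; the anonymous module keeps the two apart.
module _ where
  open import Agda.Builtin.FromNat using (Number; fromNat)
  open import Algebra.Bundles using (AbelianGroup)
  open import Data.Bool using (Bool; true; false; T)
  open import Data.Empty using (⊥-elim)
  open import Data.Integer as ℤ using (ℤ; +_; -[1+_]; _+_; _-_; _*_; -_; ∣_∣)
  import Data.Integer.Literals as ℤ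
  import Data.Integer.Properties as ℤ
  open import Data.Integer.Tactic.RingSolver using (solve-∀)
  open import Algebra.Properties.Group (AbelianGroup.group ℤ.+-0-abelianGroup) using (x≈z//y)
    renaming (∙-cancelˡ to +-cancelˡ; ∙-cancelʳ to +-cancelʳ)
  open import Data.List
    using (List; []; _∷_; _++_; length; map; filter; concatMap; applyDownFrom; cartesianProduct)
  import Data.List.Properties as List
  open import Data.List.Membership.Propositional using (_∈_)
  open import Data.List.Membership.Propositional.Properties
  open import Data.List.Membership.Propositional.Properties.WithK using (unique∧set⇒bag)
  open import Data.List.Relation.Binary.BagAndSetEquality using (_∼[_]_; set; ∼bag⇒↭)
  open import Data.List.Relation.Binary.Permutation.Propositional.Properties using (↭-length)
  open import Data.List.Relation.Unary.All as All using (All; []; _∷_)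
  open import Data.List.Relation.Unary.Any using (here; there)
  open import Data.List.Relation.Unary.AllPairs using ([]; _∷_)
  open import Data.List.Relation.Unary.Unique.Propositional using (Unique)
  import Data.List.Relation.Unary.Unique.Propositional.Properties as Unique
  open import Data.Nat as ℕ using (ℕ; zero; suc; z≤n; s≤s)
  import Data.Nat.Literals as ℕ
  import Data.Nat.Properties as ℕ
  open import Data.Product using (∃; _×_; _,_; proj₁; proj₂)
  open import Data.Unit using (tt)
  open import Function using (id; _∘_; case_of_)
  open import Function.Bundles using (mk⇔)
  open import Relation.Binary.PropositionalEquality
  open import Relation.Nullary using (contradiction)
  open import Relation.Unary using (Decidable)

  instance
    ℕ-number : Number ℕ
    ℕ-number = ℕ.number

    ℤ-number : Number ℤ
    ℤ-number = ℤ.number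

  ℤ⁴ : Set
  ℤ⁴ = ℤ × ℤ × ℤ × ℤ

  -- Counting solution sets

  unique∧set⇒length-≡ : {A : Set} {xs ys : List A} →
                        Unique xs → Unique ys → xs ∼[ set ] ys → length xs ≡ length ys
  unique∧set⇒length-≡ uxs uys xs≈ys = ↭-length (∼bag⇒↭ (unique∧set⇒bag uxs uys xs≈ys))

  map⁺-injectiveOn : {A B : Set} (f : A → B) {xs : List A} →
                     (∀ {a a′} → a ∈ xs → a′ ∈ xs → f a ≡ f a′ → a ≡ a′) →
                     Unique xs → Unique (map f xs)
  map⁺-injectiveOn f {[]} inj [] = []
  map⁺-injectiveOn f {a ∷ xs} inj (a∉xs ∷ uxs) =
    fa∉fxs ∷ map⁺-injectiveOn f (λ p q → inj (there p) (there q)) uxs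
    where
    fa∉fxs : All (f a ≢_) (map f xs)
    fa∉fxs = All.tabulate λ b∈fxs fa≡b → case ∈-map⁻ f b∈fxs of λ where
      (a′ , a′∈xs , b≡fa′) →
        All.lookup a∉xs a′∈xs (inj (here refl) (there a′∈xs) (trans fa≡b b≡fa′))

  length-cartesianProduct : {A B : Set} (xs : List A) (ys : List B) →
                            length (cartesianProduct xs ys) ≡ length xs ℕ.* length ys
  length-cartesianProduct [] ys = refl
  length-cartesianProduct (x ∷ xs) ys = begin
    length (map (x ,_) ys ++ cartesianProduct xs ys)
      ≡⟨ List.length-++ (map (x ,_) ys) ⟩
    length (map (x ,_) ys) ℕ.+ length (cartesianProduct xs ys)
      ≡⟨ cong₂ ℕ._+_ (List.length-map (x ,_) ys) (length-cartesianProduct xs ys) ⟩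
    length ys ℕ.+ length xs ℕ.* length ys
      ∎
    where open ≡-Reasoning

  module _ {A B : Set} {P : A → Set} {R : B → Set} (P? : Decidable P) (R? : Decidable R)
           {xs : List A} {ys : List B} (uxs : Unique xs) (uys : Unique ys)
           (P⊆xs : ∀ {a} → P a → a ∈ xs) (R⊆ys : ∀ {b} → R b → b ∈ ys)
           (f : Bool × A → B) where

    private
      bools : List Bool
      bools = true ∷ false ∷ []

      ∈-bools : ∀ i → i ∈ bools
      ∈-bools true = here refl
      ∈-bools false = there (here refl)

    two-to-one-count :
      (∀ {i a} → P a → R (f (i , a))) →
      (∀ {i j a a′} → P a → P a′ → f (i , a) ≡ f (j , a′) → (i , a) ≡ (j , a′)) →
      (∀ {b} → R b → ∃ λ ia → P (proj₂ ia) × f ia ≡ b) →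
      2 ℕ.* length (filter P? xs) ≡ length (filter R? ys)
    two-to-one-count f-into f-inj f-onto = begin
      2 ℕ.* length S         ≡⟨ sym (length-cartesianProduct bools S) ⟩
      length D               ≡⟨ sym (List.length-map f D) ⟩
      length (map f D)       ≡⟨ unique∧set⇒length-≡ uimage (Unique.filter⁺ R? uys) (mk⇔ to from) ⟩
      length (filter R? ys)  ∎
      where
      open ≡-Reasoning
      S = filter P? xs
      D = cartesianProduct bools S
      P-of : ∀ {i a} → (i , a) ∈ D → P a
      P-of ia∈D = proj₂ (∈-filter⁻ P? {xs = xs} (proj₂ (∈-cartesianProduct⁻ bools S ia∈D)))
      uimage : Unique (map f D)
      uimage = map⁺-injectiveOn f (λ p q → f-inj (P-of p) (P-of q))
                 (Unique.cartesianProduct⁺ (((λ ()) ∷ []) ∷ [] ∷ []) (Unique.filter⁺ P? uxs))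
      to : ∀ {b} → b ∈ map f D → b ∈ filter R? ys
      to b∈ with (i , a) , ia∈D , refl ← ∈-map⁻ f b∈ = ∈-filter⁺ R? (R⊆ys Rb) Rb
        where Rb = f-into (P-of ia∈D)
      from : ∀ {b} → b ∈ filter R? ys → b ∈ map f D
      from b∈ with (i , a) , Pa , refl ← f-onto (proj₂ (∈-filter⁻ R? {xs = ys} b∈)) =
        ∈-map⁺ f (∈-cartesianProduct⁺ (∈-bools i) (∈-filter⁺ P? (P⊆xs Pa) Pa))

  -- The search boxes of t and N

  recursion⇒applyDownFrom : {A : Set} (f : ℕ → A) (G : ℕ → List A) →
    G 0 ≡ [] → (∀ k → G (suc k) ≡ f k ∷ G k) → ∀ n → G n ≡ applyDownFrom f n
  recursion⇒applyDownFrom f G G0 GS zero = G0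
  recursion⇒applyDownFrom f G G0 GS (suc n) =
    trans (GS n) (cong (f n ∷_) (recursion⇒applyDownFrom f G G0 GS n))

  shift : ℕ → ℕ → ℤ
  shift m k = + k - + m

  -- window is built by a local function that cannot be named here; once 2 * m is abstracted,
  -- unification instantiates G with it.
  window≡applyDownFrom : ∀ m → window m ≡ applyDownFrom (shift m) (2 ℕ.+ 2 ℕ.* m)
  window≡applyDownFrom m with recursion⇒applyDownFrom (shift m) _ refl (λ _ → refl) | 2 ℕ.* m
  ... | go≡ | k = cong₂ _∷_ refl (cong₂ _∷_ refl (go≡ k))

  window-unique : ∀ m → Unique (window m)
  window-unique m = subst Unique (sym (window≡applyDownFrom m))
    (Unique.applyDownFrom⁺₁ (shift m) _ λ j<i _ eq →
      ℕ.<⇒≢ j<i (sym (ℤ.+-injective (+-cancelʳ (- + m) (+ _) (+ _) eq))))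

  shift∈window : ∀ {m i} → i ℕ.< 2 ℕ.+ 2 ℕ.* m → shift m i ∈ window m
  shift∈window {m} {i} i< =
    subst (shift m i ∈_) (sym (window≡applyDownFrom m)) (∈-applyDownFrom⁺ (shift m) i<)

  +∈window : ∀ {m k} → k ℕ.≤ suc m → + k ∈ window m
  +∈window {m} {k} k≤1+m =
    subst (_∈ window m) shift≡ (shift∈window (s≤s (ℕ.+-mono-≤ k≤1+m (ℕ.m≤m+n m 0))))
    where
    a+c-c : ∀ a c → a + c - c ≡ a
    a+c-c = solve-∀
    shift≡ : shift m (k ℕ.+ m) ≡ + k
    shift≡ = trans (cong (_- + m) (ℤ.pos-+ k m)) (a+c-c (+ k) (+ m))

  -[1+]∈window : ∀ {m k} → k ℕ.< m → -[1+ k ] ∈ window m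
  -[1+]∈window {m} {k} k<m = subst (_∈ window m) shift≡ (shift∈window index<)
    where
    d = m ℕ.∸ suc k
    index< : d ℕ.< 2 ℕ.+ 2 ℕ.* m
    index< = s≤s (ℕ.m≤n⇒m≤1+n (ℕ.≤-trans (ℕ.m∸n≤m m (suc k)) (ℕ.m≤m+n m _)))
    d-[s+d] : ∀ d s → d - (s + d) ≡ - s
    d-[s+d] = solve-∀
    shift≡ : shift m d ≡ -[1+ k ]
    shift≡ = begin
      + d - + m                  ≡⟨ cong (λ n → + d - + n) (sym (ℕ.m+[n∸m]≡n k<m)) ⟩
      + d - + (suc k ℕ.+ d)      ≡⟨ cong (λ n → + d - n) (ℤ.pos-+ (suc k) d) ⟩
      + d - (+ suc k + + d)      ≡⟨ d-[s+d] (+ d) (+ suc k) ⟩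
      -[1+ k ]                   ∎
      where open ≡-Reasoning

  ∣∣≤⇒∈window : ∀ {m} x → ∣ x ∣ ℕ.≤ m → x ∈ window m
  ∣∣≤⇒∈window (+ k) k≤m = +∈window (ℕ.m≤n⇒m≤1+n k≤m)
  ∣∣≤⇒∈window -[1+ k ] k<m = -[1+]∈window k<m

  concatMap-map≡map-cartesianProduct :
    {A B C : Set} (g : A × B → C) (xs : List A) (ys : List B) →
    concatMap (λ x → map (λ y → g (x , y)) ys) xs ≡ map g (cartesianProduct xs ys)
  concatMap-map≡map-cartesianProduct g [] ys = refl
  concatMap-map≡map-cartesianProduct g (x ∷ xs) ys = begin
    map (λ y → g (x , y)) ys ++ concatMap (λ x → map (λ y → g (x , y)) ys) xs
      ≡⟨ cong₂ _++_ (List.map-∘ ys) (concatMap-map≡map-cartesianProduct g xs ys) ⟩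
    map g (map (x ,_) ys) ++ map g (cartesianProduct xs ys)
      ≡⟨ sym (List.map-++ g (map (x ,_) ys) (cartesianProduct xs ys)) ⟩
    map g (cartesianProduct (x ∷ xs) ys)
      ∎
    where open ≡-Reasoning

  cube : ℕ → List ℤ⁴
  cube m = cartesianProduct W (cartesianProduct W (cartesianProduct W W))
    where W = window m

  box4≡cube : ∀ m → box4 m ≡ cube m
  box4≡cube m = begin
    concatMap (λ x → concatMap (λ y → concatMap (λ z → map (λ w → (x , y , z , w)) W) W) W) W
      ≡⟨ List.concatMap-cong (λ x → List.concatMap-cong (λ y →
           concatMap-map≡map-cartesianProduct (λ zw → (x , y , zw)) W W) W) W ⟩
    concatMap (λ x → concatMap (λ y → map (λ zw → (x , y , zw)) (cartesianProduct W W)) W) W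
      ≡⟨ List.concatMap-cong (λ x → concatMap-map≡map-cartesianProduct (x ,_) W (cartesianProduct W W)) W ⟩
    concatMap (λ x → map (x ,_) (cartesianProduct W (cartesianProduct W W))) W
      ≡⟨ concatMap-map≡map-cartesianProduct id W (cartesianProduct W (cartesianProduct W W)) ⟩
    map id (cube m)
      ≡⟨ List.map-id (cube m) ⟩
    cube m
      ∎
    where
    open ≡-Reasoning
    W = window m

  box4-unique : ∀ m → Unique (box4 m)
  box4-unique m = subst Unique (sym (box4≡cube m))
    (Unique.cartesianProduct⁺ W! (Unique.cartesianProduct⁺ W! (Unique.cartesianProduct⁺ W! W!)))
    where W! = window-unique m

  ∈-box4 : ∀ {m x y z w} → x ∈ window m → y ∈ window m → z ∈ window m → w ∈ window m →
           (x , y , z , w) ∈ box4 m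
  ∈-box4 {m} {x} {y} {z} {w} x∈ y∈ z∈ w∈ = subst ((x , y , z , w) ∈_) (sym (box4≡cube m))
    (∈-cartesianProduct⁺ x∈ (∈-cartesianProduct⁺ y∈ (∈-cartesianProduct⁺ z∈ w∈)))

  x*x≡∣x∣*∣x∣ : ∀ x → x * x ≡ + (∣ x ∣ ℕ.* ∣ x ∣)
  x*x≡∣x∣*∣x∣ (+ k) = sym (ℤ.pos-* k k)
  x*x≡∣x∣*∣x∣ -[1+ k ] = refl

  x*[x-1]≡∣x∣*∣x-1∣ : ∀ x → x * (x - 1) ≡ + (∣ x ∣ ℕ.* ∣ x - 1 ∣)
  x*[x-1]≡∣x∣*∣x-1∣ (+ zero) = refl
  x*[x-1]≡∣x∣*∣x-1∣ (+ suc j) = sym (ℤ.pos-* (suc j) j)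
  x*[x-1]≡∣x∣*∣x-1∣ -[1+ k ] = refl

  sq≤⇒∈window : ∀ {m} x → ∣ x ∣ ℕ.* ∣ x ∣ ℕ.≤ m → x ∈ window m
  sq≤⇒∈window x sq≤m with ∣ x ∣ in ∣x∣≡
  ... | zero = ∣∣≤⇒∈window x (subst (ℕ._≤ _) (sym ∣x∣≡) z≤n)
  ... | suc k =
    ∣∣≤⇒∈window x (subst (ℕ._≤ _) (sym ∣x∣≡) (ℕ.≤-trans (ℕ.m≤m*n (suc k) (suc k)) sq≤m))

  pronic≤⇒∈window : ∀ {n} x → ∣ x ∣ ℕ.* ∣ x - 1 ∣ ℕ.≤ 2 ℕ.* n → x ∈ window n
  pronic≤⇒∈window (+ zero) _ = +∈window z≤n
  pronic≤⇒∈window (+ suc j) pr≤2n =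
    +∈window (s≤s (ℕ.*-cancelˡ-≤ 2 (ℕ.≤-trans (2j≤[1+j]j j) pr≤2n)))
    where
    2j≤[1+j]j : ∀ j → 2 ℕ.* j ℕ.≤ suc j ℕ.* j
    2j≤[1+j]j zero = z≤n
    2j≤[1+j]j (suc j) = ℕ.*-monoˡ-≤ (suc j) (s≤s (s≤s (z≤n {j})))
  pronic≤⇒∈window -[1+ k ] pr≤2n = -[1+]∈window (ℕ.*-cancelˡ-≤ 2 (ℕ.≤-trans 2[1+k]≤ pr≤2n))
    where
    -- ∣ -[1+ k ] - 1 ∣ computes to 2 + (k + 0).
    2[1+k]≤ : 2 ℕ.* suc k ℕ.≤ suc k ℕ.* suc (suc (k ℕ.+ 0))
    2[1+k]≤ = subst (ℕ._≤ suc k ℕ.* suc (suc (k ℕ.+ 0))) (ℕ.*-comm (suc k) 2)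
                (ℕ.*-monoʳ-≤ (suc k) (s≤s (s≤s (z≤n {k ℕ.+ 0}))))

  form-cong : ∀ a b c d {X X′ Y Y′ Z Z′ W W′ : ℤ} →
              X ≡ X′ → Y ≡ Y′ → Z ≡ Z′ → W ≡ W′ →
              + a * X + + b * Y + + c * Z + + d * W ≡ + a * X′ + + b * Y′ + + c * Z′ + + d * W′
  form-cong a b c d refl refl refl refl = refl

  summands≤ : ∀ {a b c d s t u v M : ℕ} .{{_ : ℕ.NonZero a}} .{{_ : ℕ.NonZero b}}
              .{{_ : ℕ.NonZero c}} .{{_ : ℕ.NonZero d}} →
              + a * + s + + b * + t + + c * + u + + d * + v ≡ + M →
              s ℕ.≤ M × t ℕ.≤ M × u ℕ.≤ M × v ℕ.≤ M
  summands≤ {a} {b} {c} {d} {s} {t} {u} {v} {M} eq =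
    ℕ.≤-trans (ℕ.m≤n*m s a) (ℕ.≤-trans (ℕ.m≤m+n A B) AB≤M) ,
    ℕ.≤-trans (ℕ.m≤n*m t b) (ℕ.≤-trans (ℕ.m≤n+m B A) AB≤M) ,
    ℕ.≤-trans (ℕ.m≤n*m u c) (ℕ.≤-trans (ℕ.m≤n+m C (A ℕ.+ B)) ABC≤M) ,
    ℕ.≤-trans (ℕ.m≤n*m v d) (subst (D ℕ.≤_) sum≡M (ℕ.m≤n+m D (A ℕ.+ B ℕ.+ C)))
    where
    A = a ℕ.* s
    B = b ℕ.* t
    C = c ℕ.* u
    D = d ℕ.* v
    sum≡M : A ℕ.+ B ℕ.+ C ℕ.+ D ≡ M
    sum≡M = ℤ.+-injective (trans +-sum eq)
      where
      +-sum : + (A ℕ.+ B ℕ.+ C ℕ.+ D) ≡ + a * + s + + b * + t + + c * + u + + d * + v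
      +-sum = trans (ℤ.pos-+ (A ℕ.+ B ℕ.+ C) D) (cong₂ _+_
                (trans (ℤ.pos-+ (A ℕ.+ B) C) (cong₂ _+_
                  (trans (ℤ.pos-+ A B) (cong₂ _+_ (ℤ.pos-* a s) (ℤ.pos-* b t)))
                  (ℤ.pos-* c u)))
                (ℤ.pos-* d v))
    ABC≤M : A ℕ.+ B ℕ.+ C ℕ.≤ M
    ABC≤M = subst (A ℕ.+ B ℕ.+ C ℕ.≤_) sum≡M (ℕ.m≤m+n (A ℕ.+ B ℕ.+ C) D)
    AB≤M : A ℕ.+ B ℕ.≤ M
    AB≤M = ℕ.≤-trans (ℕ.m≤m+n (A ℕ.+ B) C) ABC≤M

  Q-solution∈box4 : ∀ {a b c d M} .{{_ : ℕ.NonZero a}} .{{_ : ℕ.NonZero b}} .{{_ : ℕ.NonZero c}}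
                    .{{_ : ℕ.NonZero d}} v → Q a b c d v ≡ + M → v ∈ box4 M
  Q-solution∈box4 {a} {b} {c} {d} (x , y , z , w) eq
    with x≤ , y≤ , z≤ , w≤ ← summands≤ {a} {b} {c} {d} (trans (sym (form-cong a b c d
           (x*x≡∣x∣*∣x∣ x) (x*x≡∣x∣*∣x∣ y) (x*x≡∣x∣*∣x∣ z) (x*x≡∣x∣*∣x∣ w))) eq)
    = ∈-box4 (sq≤⇒∈window x x≤) (sq≤⇒∈window y y≤)
             (sq≤⇒∈window z z≤) (sq≤⇒∈window w w≤)

  T2-solution∈box4 : ∀ {a b c d n} .{{_ : ℕ.NonZero a}} .{{_ : ℕ.NonZero b}} .{{_ : ℕ.NonZero c}}
                     .{{_ : ℕ.NonZero d}} v → T2 a b c d v ≡ + (2 ℕ.* n) → v ∈ box4 n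
  T2-solution∈box4 {a} {b} {c} {d} (x , y , z , w) eq
    with x≤ , y≤ , z≤ , w≤ ← summands≤ {a} {b} {c} {d} (trans (sym (form-cong a b c d
           (x*[x-1]≡∣x∣*∣x-1∣ x) (x*[x-1]≡∣x∣*∣x-1∣ y)
           (x*[x-1]≡∣x∣*∣x-1∣ z) (x*[x-1]≡∣x∣*∣x-1∣ w))) eq)
    = ∈-box4 (pronic≤⇒∈window x x≤) (pronic≤⇒∈window y y≤)
             (pronic≤⇒∈window z z≤) (pronic≤⇒∈window w w≤)

  -- Parity and residues

  -- Odd numbers are written 2k - 1, so that k is the triangular coordinate.
  data Parity (x : ℤ) : Set where
    even : ∀ k → x ≡ 2 * k → Parity x
    odd  : ∀ k → x ≡ 2 * k - 1 → Parity x

  private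
    parity-+ : ∀ n → Parity (+ n)
    parity-+ zero = even 0 refl
    parity-+ (suc n) with parity-+ n
    ... | even k n≡2k = odd (k + 1) (trans (cong (λ t → 1 + t) n≡2k) (1+2k k))
      where
      1+2k : ∀ k → 1 + 2 * k ≡ 2 * (k + 1) - 1
      1+2k = solve-∀
    ... | odd k n≡2k-1 = even k (trans (cong (λ t → 1 + t) n≡2k-1) (1+[2k-1] k))
      where
      1+[2k-1] : ∀ k → 1 + (2 * k - 1) ≡ 2 * k
      1+[2k-1] = solve-∀

  parity : ∀ x → Parity x
  parity (+ n) = parity-+ n
  parity -[1+ n ] with parity-+ (suc n)
  ... | even k n≡2k = even (- k) (trans (cong -_ n≡2k) (-[2k] k))
    where
    -[2k] : ∀ k → - (2 * k) ≡ 2 * (- k)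
    -[2k] = solve-∀
  ... | odd k n≡2k-1 = odd (1 - k) (trans (cong -_ n≡2k-1) (-[2k-1] k))
    where
    -[2k-1] : ∀ k → - (2 * k - 1) ≡ 2 * (1 - k) - 1
    -[2k-1] = solve-∀

  odd-square : ∀ a → ∃ λ m → (2 * a - 1) * (2 * a - 1) ≡ 8 * m + 1
  odd-square a with parity a
  ... | even α refl = 2 * α * α - α , sq α
    where
    sq : ∀ α → (2 * (2 * α) - 1) * (2 * (2 * α) - 1) ≡ 8 * (2 * α * α - α) + 1
    sq = solve-∀
  ... | odd α refl = 2 * α * α - 3 * α + 1 , sq α
    where
    sq : ∀ α → (2 * (2 * α - 1) - 1) * (2 * (2 * α - 1) - 1) ≡ 8 * (2 * α * α - 3 * α + 1) + 1
    sq = solve-∀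

  mc+i≡md+j⇒m[c-d]≡j-i : ∀ {k c d i j} → k * c + i ≡ k * d + j → k * (c - d) ≡ j - i
  mc+i≡md+j⇒m[c-d]≡j-i {k} {c} {d} {i} {j} eq = begin
    k * (c - d)                               ≡⟨ expand k c d i j ⟩
    (k * c + i) - (k * d + j) + (j - i)       ≡⟨ cong (λ t → t - (k * d + j) + (j - i)) eq ⟩
    (k * d + j) - (k * d + j) + (j - i)       ≡⟨ cancel (k * d + j) (j - i) ⟩
    j - i                                     ∎
    where
    open ≡-Reasoning
    expand : ∀ k c d i j → k * (c - d) ≡ (k * c + i) - (k * d + j) + (j - i)
    expand = solve-∀
    cancel : ∀ a b → a - a + b ≡ b
    cancel = solve-∀

  residue-unique : ∀ m {i j} {C D : ℤ} → i ℕ.< m → j ℕ.< m →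
                   + m * C + + i ≡ + m * D + + j → i ≡ j
  residue-unique m {i} {j} {C} {D} i<m j<m eq = by-∣C-D∣ ∣ C - D ∣ refl
    where
    m[C-D]≡j-i : + m * (C - D) ≡ + j - + i
    m[C-D]≡j-i = mc+i≡md+j⇒m[c-d]≡j-i {+ m} {C} {D} {+ i} {+ j} eq
    by-∣C-D∣ : ∀ n → ∣ C - D ∣ ≡ n → i ≡ j
    by-∣C-D∣ zero ∣C-D∣≡0 = ℤ.+-injective (sym (ℤ.i-j≡0⇒i≡j (+ j) (+ i) (begin
      + j - + i       ≡⟨ sym m[C-D]≡j-i ⟩
      + m * (C - D)   ≡⟨ cong (+ m *_) (ℤ.∣i∣≡0⇒i≡0 ∣C-D∣≡0) ⟩
      + m * 0         ≡⟨ ℤ.*-zeroʳ (+ m) ⟩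
      0               ∎)))
      where open ≡-Reasoning
    by-∣C-D∣ (suc n) ∣C-D∣≡1+n = contradiction (begin-strict
      m                      ≤⟨ ℕ.m≤m*n m (suc n) ⟩
      m ℕ.* suc n            ≡⟨ cong (m ℕ.*_) (sym ∣C-D∣≡1+n) ⟩
      m ℕ.* ∣ C - D ∣        ≡⟨ sym (ℤ.abs-* (+ m) (C - D)) ⟩
      ∣ + m * (C - D) ∣      ≡⟨ cong ∣_∣ (trans m[C-D]≡j-i (ℤ.m-n≡m⊖n j i)) ⟩
      ∣ j ℤ.⊖ i ∣            ≤⟨ ℤ.∣m⊝n∣≤m⊔n j i ⟩
      j ℕ.⊔ i                <⟨ ℕ.⊔-lub j<m i<m ⟩
      m                      ∎) (ℕ.<-irrefl refl)
      where open ℕ.≤-Reasoning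

  residues-agree : ∀ m {i j} {L R : ℤ} (C D : ℤ) {i<m : T (i ℕ.<ᵇ m)} {j<m : T (j ℕ.<ᵇ m)} →
                   L ≡ R → L ≡ + m * C + + i → R ≡ + m * D + + j → i ≡ j
  residues-agree m {i} {j} _ _ {i<m} {j<m} L≡R L≡ R≡ =
    residue-unique m (ℕ.<ᵇ⇒< i m i<m) (ℕ.<ᵇ⇒< j m j<m) (trans (sym L≡) (trans L≡R R≡))

  2x-1≢2y : ∀ x y → 2 * x - 1 ≢ 2 * y
  2x-1≢2y x y eq = contradiction (residues-agree 2 (x - 1) y eq (odd-form x) (even-form y)) λ ()
    where
    odd-form : ∀ x → 2 * x - 1 ≡ 2 * (x - 1) + 1
    odd-form = solve-∀
    even-form : ∀ y → 2 * y ≡ 2 * y + 0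
    even-form = solve-∀

  2x-1-injective : ∀ x y → 2 * x - 1 ≡ 2 * y - 1 → x ≡ y
  2x-1-injective x y eq = ℤ.*-cancelˡ-≡ 2 x y (+-cancelʳ (- 1) (2 * x) (2 * y) eq)

  sum-difference-injective : ∀ {y z y′ z′} →
                             y + z ≡ y′ + z′ → y - z ≡ y′ - z′ → y ≡ y′ × z ≡ z′
  sum-difference-injective {y} {z} {y′} {z′} sum≡ diff≡ =
    ℤ.*-cancelˡ-≡ 2 y y′ (trans (2y y z) (trans (cong₂ _+_ sum≡ diff≡) (sym (2y y′ z′)))) ,
    ℤ.*-cancelˡ-≡ 2 z z′ (trans (2z y z) (trans (cong₂ _-_ sum≡ diff≡) (sym (2z y′ z′))))
    where
    2y : ∀ y z → 2 * y ≡ (y + z) + (y - z)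
    2y = solve-∀
    2z : ∀ y z → 2 * z ≡ (y + z) - (y - z)
    2z = solve-∀

  x+y-1≡t⇒x≡t+1-y : ∀ x y {t} → x + y - 1 ≡ t → x ≡ t + 1 - y
  x+y-1≡t⇒x≡t+1-y x y refl = solve x y
    where
    solve : ∀ x y → x ≡ x + y - 1 + 1 - y
    solve = solve-∀

  quadruple-≡ : ∀ {x y z w x′ y′ z′ w′ : ℤ} → x ≡ x′ → y ≡ y′ → z ≡ z′ → w ≡ w′ →
                (x , y , z , w) ≡ (x′ , y′ , z′ , w′)
  quadruple-≡ refl refl refl refl = refl

  -- Odd representations

  odd⁴ : ℤ⁴ → ℤ⁴
  odd⁴ (x , y , z , w) = (2 * x - 1 , 2 * y - 1 , 2 * z - 1 , 2 * w - 1)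

  Q-odd⁴ : ∀ a b c d v → Q a b c d (odd⁴ v) ≡ 4 * T2 a b c d v + + (a ℕ.+ b ℕ.+ c ℕ.+ d)
  Q-odd⁴ a b c d (x , y , z , w) = begin
    Q a b c d (odd⁴ (x , y , z , w))         ≡⟨ identity (+ a) (+ b) (+ c) (+ d) x y z w ⟩
    4 * T2 a b c d (x , y , z , w) + (+ a + + b + + c + + d)
      ≡⟨ cong (λ t → 4 * T2 a b c d (x , y , z , w) + t) (sym (trans (ℤ.pos-+ (a ℕ.+ b ℕ.+ c) d)
           (cong (_+ + d) (trans (ℤ.pos-+ (a ℕ.+ b) c) (cong (_+ + c) (ℤ.pos-+ a b)))))) ⟩
    4 * T2 a b c d (x , y , z , w) + + (a ℕ.+ b ℕ.+ c ℕ.+ d) ∎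
    where
    open ≡-Reasoning
    identity : ∀ A B C D x y z w →
      A * ((2 * x - 1) * (2 * x - 1)) + B * ((2 * y - 1) * (2 * y - 1)) +
      C * ((2 * z - 1) * (2 * z - 1)) + D * ((2 * w - 1) * (2 * w - 1))
      ≡ 4 * (A * (x * (x - 1)) + B * (y * (y - 1)) + C * (z * (z - 1)) + D * (w * (w - 1))) + (A + B + C + D)
    identity = solve-∀

  odd⁴-injective : ∀ {v v′} → odd⁴ v ≡ odd⁴ v′ → v ≡ v′
  odd⁴-injective {x , y , z , w} {x′ , y′ , z′ , w′} eq =
    quadruple-≡ (2x-1-injective x x′ (cong proj₁ eq))
                (2x-1-injective y y′ (cong (proj₁ ∘ proj₂) eq))
                (2x-1-injective z z′ (cong (proj₁ ∘ proj₂ ∘ proj₂) eq))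
                (2x-1-injective w w′ (cong (proj₂ ∘ proj₂ ∘ proj₂) eq))

  module _ (a b c d : ℕ)
           .{{_ : ℕ.NonZero a}} .{{_ : ℕ.NonZero b}} .{{_ : ℕ.NonZero c}} .{{_ : ℕ.NonZero d}}
           (a′ b′ c′ d′ : ℕ)
           .{{_ : ℕ.NonZero a′}} .{{_ : ℕ.NonZero b′}} .{{_ : ℕ.NonZero c′}} .{{_ : ℕ.NonZero d′}}
           (m k : ℕ) (f : Bool × ℤ⁴ → ℤ⁴) where
    private
      τ κ : ℤ⁴ → ℤ
      τ = T2 a b c d
      κ = Q a′ b′ c′ d′

    2t≡N : (∀ i v → κ (f (i , v)) ≡ 4 * τ v + + k) →
           (∀ {i j v v′} → τ v ≡ 2 * + m → τ v′ ≡ 2 * + m →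
              f (i , v) ≡ f (j , v′) → (i , v) ≡ (j , v′)) →
           (∀ {u} → κ u ≡ 8 * + m + + k → ∃ λ iv → f iv ≡ u) →
           2 ℕ.* t a b c d m ≡ N a′ b′ c′ d′ (8 ℕ.* m ℕ.+ k)
    2t≡N κ∘f f-inj f-onto =
      two-to-one-count (λ v → τ v ℤ.≟ + (2 ℕ.* m)) (λ u → κ u ℤ.≟ + (8 ℕ.* m ℕ.+ k))
        (box4-unique m) (box4-unique (8 ℕ.* m ℕ.+ k))
        (T2-solution∈box4 {a} {b} {c} {d} _) (Q-solution∈box4 {a′} {b′} {c′} {d′} _) f
        into (λ τv≡ τv′≡ → f-inj (trans τv≡ 2m≡) (trans τv′≡ 2m≡)) onto
      where
      open ≡-Reasoning
      2m≡ : + (2 ℕ.* m) ≡ 2 * + m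
      2m≡ = ℤ.pos-* 2 m
      8m+k≡ : + (8 ℕ.* m ℕ.+ k) ≡ 8 * + m + + k
      8m+k≡ = trans (ℤ.pos-+ (8 ℕ.* m) k) (cong (_+ + k) (ℤ.pos-* 8 m))
      4[2m]+k : ∀ m k → 4 * (2 * m) + k ≡ 8 * m + k
      4[2m]+k = solve-∀
      into : ∀ {i v} → τ v ≡ + (2 ℕ.* m) → κ (f (i , v)) ≡ + (8 ℕ.* m ℕ.+ k)
      into {i} {v} τv≡ = begin
        κ (f (i , v))        ≡⟨ κ∘f i v ⟩
        4 * τ v + + k        ≡⟨ cong (λ x → 4 * x + + k) (trans τv≡ 2m≡) ⟩
        4 * (2 * + m) + + k  ≡⟨ 4[2m]+k (+ m) (+ k) ⟩
        8 * + m + + k        ≡⟨ sym 8m+k≡ ⟩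
        + (8 ℕ.* m ℕ.+ k)    ∎
      onto : ∀ {u} → κ u ≡ + (8 ℕ.* m ℕ.+ k) → ∃ λ iv → τ (proj₂ iv) ≡ + (2 ℕ.* m) × f iv ≡ u
      onto {u} κu≡ with (i , v) , fiv≡u ← f-onto (trans κu≡ 8m+k≡) = (i , v) , τv≡ , fiv≡u
        where
        -- The instance is given explicitly: the module's NonZero instances would be tried first.
        τv≡ : τ v ≡ + (2 ℕ.* m)
        τv≡ = trans (ℤ.*-cancelˡ-≡ 4 (τ v) (2 * + m) {{ℕ.nonZero}} (+-cancelʳ (+ k) _ _ (begin
          4 * τ v + + k        ≡⟨ sym (κ∘f i v) ⟩
          κ (f (i , v))        ≡⟨ cong κ fiv≡u ⟩
          κ u                  ≡⟨ trans κu≡ 8m+k≡ ⟩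
          8 * + m + + k        ≡⟨ sym (4[2m]+k (+ m) (+ k)) ⟩
          4 * (2 * + m) + + k  ∎))) (sym 2m≡)

  -- t(1,2,2,6; n) and N(1,1,4,6; 8n + 11)

  swap₁₂ : ℤ⁴ → ℤ⁴
  swap₁₂ (p , q , r , s) = (q , p , r , s)

  Q-swap₁₂ : ∀ a c d u → Q a a c d (swap₁₂ u) ≡ Q a a c d u
  Q-swap₁₂ a c d (p , q , r , s) =
    cong (λ t → t + + c * (r * r) + + d * (s * s)) (ℤ.+-comm (+ a * (q * q)) (+ a * (p * p)))

  φ₁ : ℤ⁴ → ℤ⁴
  φ₁ (x , y , z , w) = (2 * x - 1 , 2 * (y + z - 1) , y - z , 2 * w - 1)

  Q-φ₁ : ∀ v → Q 1 1 4 6 (φ₁ v) ≡ 4 * T2 1 2 2 6 v + 11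
  Q-φ₁ (x , y , z , w) = identity x y z w
    where
    identity : ∀ x y z w →
      1 * ((2 * x - 1) * (2 * x - 1)) + 1 * (2 * (y + z - 1) * (2 * (y + z - 1))) +
      4 * ((y - z) * (y - z)) + 6 * ((2 * w - 1) * (2 * w - 1))
      ≡ 4 * (1 * (x * (x - 1)) + 2 * (y * (y - 1)) + 2 * (z * (z - 1)) + 6 * (w * (w - 1))) + 11
    identity = solve-∀

  φ₁-injective : ∀ {v v′} → φ₁ v ≡ φ₁ v′ → v ≡ v′
  φ₁-injective {x , y , z , w} {x′ , y′ , z′ , w′} eq
    with refl ← 2x-1-injective x x′ (cong proj₁ eq)
       | refl ← 2x-1-injective w w′ (cong (proj₂ ∘ proj₂ ∘ proj₂) eq)
    with refl , refl ← sum-difference-injective {y} {z} {y′} {z′}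
           (+-cancelʳ (- 1) (y + z) (y′ + z′)
             (ℤ.*-cancelˡ-≡ 2 (y + z - 1) (y′ + z′ - 1) (cong (proj₁ ∘ proj₂) eq)))
           (cong (proj₁ ∘ proj₂ ∘ proj₂) eq)
    = refl

  φ₁-surjective : ∀ N a b r s → Q 1 1 4 6 (2 * a - 1 , 2 * b , r , s) ≡ 8 * N + 11 →
                  ∃ λ v → φ₁ v ≡ (2 * a - 1 , 2 * b , r , s)
  φ₁-surjective N a b r s E with parity s
  ... | even k refl = contradiction
    (residues-agree 4 (a * a - a + b * b + r * r + 6 * (k * k)) (2 * N + 2) E (lhs a b r k) (rhs N)) λ ()
    where
    lhs : ∀ a b r k → 1 * ((2 * a - 1) * (2 * a - 1)) + 1 * (2 * b * (2 * b)) + 4 * (r * r) + 6 * (2 * k * (2 * k))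
                      ≡ 4 * (a * a - a + b * b + r * r + 6 * (k * k)) + 1
    lhs = solve-∀
    rhs : ∀ N → 8 * N + 11 ≡ 4 * (2 * N + 2) + 3
    rhs = solve-∀
  ... | odd k refl with parity (b + r)
  ...   | even j b+r≡2j with refl ← x≈z//y b r (2 * j) b+r≡2j
    with m₁ , a² ← odd-square a | m₂ , k² ← odd-square k = contradiction
    (residues-agree 8 (m₁ + 2 * j * j - 2 * j * r + r * r + 6 * m₂) (N + 1) E
      (trans (form-cong 1 1 4 6 a² refl refl k²) (lhs m₁ j r m₂)) (rhs N)) λ ()
    where
    lhs : ∀ m₁ j r m₂ → 1 * (8 * m₁ + 1) + 1 * (2 * (2 * j - r) * (2 * (2 * j - r))) + 4 * (r * r) + 6 * (8 * m₂ + 1)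
                        ≡ 8 * (m₁ + 2 * j * j - 2 * j * r + r * r + 6 * m₂) + 7
    lhs = solve-∀
    rhs : ∀ N → 8 * N + 11 ≡ 8 * (N + 1) + 3
    rhs = solve-∀
  ...   | odd j b+r≡2j-1 with refl ← x≈z//y b r (2 * j - 1) b+r≡2j-1 =
    (a , j , j - r , k) , quadruple-≡ refl (q≡ j r) (r≡ j r) refl
    where
    q≡ : ∀ j r → 2 * (j + (j - r) - 1) ≡ 2 * (2 * j - 1 - r)
    q≡ = solve-∀
    r≡ : ∀ j r → j - (j - r) ≡ r
    r≡ = solve-∀

  f₁ : Bool × ℤ⁴ → ℤ⁴
  f₁ (true , v) = φ₁ v
  f₁ (false , v) = swap₁₂ (φ₁ v)

  Q-f₁ : ∀ i v → Q 1 1 4 6 (f₁ (i , v)) ≡ 4 * T2 1 2 2 6 v + 11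
  Q-f₁ true v = Q-φ₁ v
  Q-f₁ false v = trans (Q-swap₁₂ 1 4 6 (φ₁ v)) (Q-φ₁ v)

  f₁-injective : ∀ {a a′} → f₁ a ≡ f₁ a′ → a ≡ a′
  f₁-injective {true , v} {true , v′} eq = cong (true ,_) (φ₁-injective eq)
  f₁-injective {false , v} {false , v′} eq = cong (false ,_) (φ₁-injective (cong swap₁₂ eq))
  f₁-injective {true , x , _} {false , _ , y′ , z′ , _} eq = ⊥-elim (2x-1≢2y x (y′ + z′ - 1) (cong proj₁ eq))
  f₁-injective {false , _ , y , z , _} {true , x′ , _} eq = ⊥-elim (2x-1≢2y x′ (y + z - 1) (sym (cong proj₁ eq)))

  f₁-surjective : ∀ {N u} → Q 1 1 4 6 u ≡ 8 * N + 11 → ∃ λ a → f₁ a ≡ u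
  f₁-surjective {N} {p , q , r , s} E with parity p | parity q
  ... | even a refl | even b refl = contradiction
    (residues-agree 2 (2 * a * a + 2 * b * b + 2 * r * r + 3 * s * s) (4 * N + 5) E (lhs a b r s) (rhs N)) λ ()
    where
    lhs : ∀ a b r s → 1 * (2 * a * (2 * a)) + 1 * (2 * b * (2 * b)) + 4 * (r * r) + 6 * (s * s)
                      ≡ 2 * (2 * a * a + 2 * b * b + 2 * r * r + 3 * s * s) + 0
    lhs = solve-∀
    rhs : ∀ N → 8 * N + 11 ≡ 2 * (4 * N + 5) + 1
    rhs = solve-∀
  ... | odd a refl | odd b refl = contradiction
    (residues-agree 2 (2 * a * a - 2 * a + 2 * b * b - 2 * b + 2 * r * r + 3 * s * s + 1) (4 * N + 5) E
      (lhs a b r s) (rhs N)) λ ()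
    where
    lhs : ∀ a b r s → 1 * ((2 * a - 1) * (2 * a - 1)) + 1 * ((2 * b - 1) * (2 * b - 1)) + 4 * (r * r) + 6 * (s * s)
                      ≡ 2 * (2 * a * a - 2 * a + 2 * b * b - 2 * b + 2 * r * r + 3 * s * s + 1) + 0
    lhs = solve-∀
    rhs : ∀ N → 8 * N + 11 ≡ 2 * (4 * N + 5) + 1
    rhs = solve-∀
  ... | odd a refl | even b refl with v , φ₁v≡u ← φ₁-surjective N a b r s E = (true , v) , φ₁v≡u
  ... | even a refl | odd b refl
    with v , φ₁v≡u ← φ₁-surjective N b a r s (trans (Q-swap₁₂ 1 4 6 (p , q , r , s)) E)
    = (false , v) , cong swap₁₂ φ₁v≡u

  2t[1,2,2,6]≡N[1,1,4,6] : ∀ n → 2 ℕ.* t 1 2 2 6 n ≡ N 1 1 4 6 (8 ℕ.* n ℕ.+ 11)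
  2t[1,2,2,6]≡N[1,1,4,6] n =
    2t≡N 1 2 2 6 1 1 4 6 n 11 f₁ Q-f₁ (λ _ _ → f₁-injective) (f₁-surjective {+ n})

  -- t(1,1,8,12; 2n) and N(1,1,8,12; 16n + 22)

  -- With A = x + y - 1 and B = x - y, the odd vector (2x - 1, 2y - 1, 2z - 1, 2w - 1) is
  -- (A + B, A - B, 2z - 1, 2w - 1), and exactly one of A, B is even. twist replaces that even one
  -- by 2(2z - 1) and puts its half into the third coordinate.
  twist-with : ∀ x y z w → Parity (x + y - 1) → ℤ⁴
  twist-with x y z w (even g _) = (2 * (2 * z - 1) + (x - y) , 2 * (2 * z - 1) - (x - y) , g , 2 * w - 1)
  twist-with x y z w (odd g _) = (x + y - 1 + 2 * (2 * z - 1) , x + y - 1 - 2 * (2 * z - 1) , g - y , 2 * w - 1)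

  twist : ℤ⁴ → ℤ⁴
  twist (x , y , z , w) = twist-with x y z w (parity (x + y - 1))

  twist-even : ∀ x y z w {g} → x + y - 1 ≡ 2 * g →
               twist (x , y , z , w) ≡ (2 * (2 * z - 1) + (x - y) , 2 * (2 * z - 1) - (x - y) , g , 2 * w - 1)
  twist-even x y z w {g} A≡2g with parity (x + y - 1)
  ... | even g′ A≡2g′ with refl ← ℤ.*-cancelˡ-≡ 2 g′ g (trans (sym A≡2g′) A≡2g) = refl
  ... | odd g′ A≡2g′-1 = ⊥-elim (2x-1≢2y g′ g (trans (sym A≡2g′-1) A≡2g))

  twist-odd : ∀ x y z w {g} → x + y - 1 ≡ 2 * g - 1 →
              twist (x , y , z , w) ≡ (x + y - 1 + 2 * (2 * z - 1) , x + y - 1 - 2 * (2 * z - 1) , g - y , 2 * w - 1)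
  twist-odd x y z w {g} A≡2g-1 with parity (x + y - 1)
  ... | even g′ A≡2g′ = ⊥-elim (2x-1≢2y g g′ (trans (sym A≡2g-1) A≡2g′))
  ... | odd g′ A≡2g′-1 with refl ← 2x-1-injective g′ g (trans (sym A≡2g′-1) A≡2g-1) = refl

  Q-twist : ∀ v → Q 1 1 8 12 (twist v) ≡ 4 * T2 1 1 8 12 v + 22
  Q-twist (x , y , z , w) with parity (x + y - 1)
  ... | even g A≡2g with refl ← x+y-1≡t⇒x≡t+1-y x y A≡2g = identity g y z w
    where
    identity : ∀ g y z w →
      1 * ((2 * (2 * z - 1) + (2 * g + 1 - y - y)) * (2 * (2 * z - 1) + (2 * g + 1 - y - y))) +
      1 * ((2 * (2 * z - 1) - (2 * g + 1 - y - y)) * (2 * (2 * z - 1) - (2 * g + 1 - y - y))) +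
      8 * (g * g) + 12 * ((2 * w - 1) * (2 * w - 1))
      ≡ 4 * (1 * ((2 * g + 1 - y) * (2 * g + 1 - y - 1)) + 1 * (y * (y - 1)) +
             8 * (z * (z - 1)) + 12 * (w * (w - 1))) + 22
    identity = solve-∀
  ... | odd g A≡2g-1 with refl ← x+y-1≡t⇒x≡t+1-y x y A≡2g-1 = identity g y z w
    where
    identity : ∀ g y z w →
      1 * ((2 * g - 1 + 1 - y + y - 1 + 2 * (2 * z - 1)) * (2 * g - 1 + 1 - y + y - 1 + 2 * (2 * z - 1))) +
      1 * ((2 * g - 1 + 1 - y + y - 1 - 2 * (2 * z - 1)) * (2 * g - 1 + 1 - y + y - 1 - 2 * (2 * z - 1))) +
      8 * ((g - y) * (g - y)) + 12 * ((2 * w - 1) * (2 * w - 1))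
      ≡ 4 * (1 * ((2 * g - 1 + 1 - y) * (2 * g - 1 + 1 - y - 1)) + 1 * (y * (y - 1)) +
             8 * (z * (z - 1)) + 12 * (w * (w - 1))) + 22
    identity = solve-∀

  even-image≢odd-image : ∀ x y z x′ y′ z′ g′ {t t′ : ℤ × ℤ} → x′ + y′ - 1 ≡ 2 * g′ - 1 →
    (2 * (2 * z - 1) + (x - y) , 2 * (2 * z - 1) - (x - y) , t)
    ≢ (x′ + y′ - 1 + 2 * (2 * z′ - 1) , x′ + y′ - 1 - 2 * (2 * z′ - 1) , t′)
  even-image≢odd-image x y z x′ y′ z′ g′ A′≡2g′-1 eq = contradiction
    (residues-agree 4 (2 * z - 1) (g′ - 1) (cong₂ _+_ (cong proj₁ eq) (cong (proj₁ ∘ proj₂) eq))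
      (even-sum x y z) (trans (odd-sum x′ y′ z′) (trans (cong (2 *_) A′≡2g′-1) (2[2g-1] g′)))) λ ()
    where
    even-sum : ∀ x y z → 2 * (2 * z - 1) + (x - y) + (2 * (2 * z - 1) - (x - y)) ≡ 4 * (2 * z - 1) + 0
    even-sum = solve-∀
    odd-sum : ∀ x y z → x + y - 1 + 2 * (2 * z - 1) + (x + y - 1 - 2 * (2 * z - 1)) ≡ 2 * (x + y - 1)
    odd-sum = solve-∀
    2[2g-1] : ∀ g → 2 * (2 * g - 1) ≡ 4 * (g - 1) + 2
    2[2g-1] = solve-∀

  twist-injective : ∀ {v v′} → twist v ≡ twist v′ → v ≡ v′
  twist-injective {x , y , z , w} {x′ , y′ , z′ , w′} eq with parity (x + y - 1) | parity (x′ + y′ - 1)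
  ... | even g A≡2g | even g′ A′≡2g′
    with refl ← cong (proj₁ ∘ proj₂ ∘ proj₂) eq
    with P≡P′ , B≡B′ ← sum-difference-injective {2 * (2 * z - 1)} {x - y} {2 * (2 * z′ - 1)} {x′ - y′}
                          (cong proj₁ eq) (cong (proj₁ ∘ proj₂) eq)
    with refl , refl ← sum-difference-injective {x} {y} {x′} {y′}
                         (+-cancelʳ (- 1) (x + y) (x′ + y′) (trans A≡2g (sym A′≡2g′))) B≡B′
    with refl ← 2x-1-injective z z′ (ℤ.*-cancelˡ-≡ 2 (2 * z - 1) (2 * z′ - 1) P≡P′)
       | refl ← 2x-1-injective w w′ (cong (proj₂ ∘ proj₂ ∘ proj₂) eq)
    = refl
  ... | odd g A≡2g-1 | odd g′ A′≡2g′-1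
    with A≡A′ , P≡P′ ← sum-difference-injective {x + y - 1} {2 * (2 * z - 1)} {x′ + y′ - 1} {2 * (2 * z′ - 1)}
                          (cong proj₁ eq) (cong (proj₁ ∘ proj₂) eq)
    with refl ← 2x-1-injective g g′ (trans (sym A≡2g-1) (trans A≡A′ A′≡2g′-1))
    with refl ← ℤ.neg-injective (+-cancelˡ g (- y) (- y′) (cong (proj₁ ∘ proj₂ ∘ proj₂) eq))
    with refl ← +-cancelʳ y x x′ (+-cancelʳ (- 1) (x + y) (x′ + y) A≡A′)
    with refl ← 2x-1-injective z z′ (ℤ.*-cancelˡ-≡ 2 (2 * z - 1) (2 * z′ - 1) P≡P′)
       | refl ← 2x-1-injective w w′ (cong (proj₂ ∘ proj₂ ∘ proj₂) eq)
    = refl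
  ... | even g A≡2g | odd g′ A′≡2g′-1 =
    ⊥-elim (even-image≢odd-image x y z x′ y′ z′ g′ A′≡2g′-1 eq)
  ... | odd g A≡2g-1 | even g′ A′≡2g′ =
    ⊥-elim (even-image≢odd-image x′ y′ z′ x y z g A≡2g-1 (sym eq))

  x-y≡2[g-y] : ∀ x y {g} → x + y - 1 ≡ 2 * g - 1 → x - y ≡ 2 * (g - y)
  x-y≡2[g-y] x y {g} A≡2g-1 = begin
    x - y                    ≡⟨ B≡ x y ⟩
    x + y - 1 + 1 - 2 * y    ≡⟨ cong (λ A → A + 1 - 2 * y) A≡2g-1 ⟩
    2 * g - 1 + 1 - 2 * y    ≡⟨ 2[g-y] g y ⟩
    2 * (g - y)              ∎
    where
    open ≡-Reasoning
    B≡ : ∀ x y → x - y ≡ x + y - 1 + 1 - 2 * y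
    B≡ = solve-∀
    2[g-y] : ∀ g y → 2 * g - 1 + 1 - 2 * y ≡ 2 * (g - y)
    2[g-y] = solve-∀

  16N+22≡16[N+1]+6 : ∀ N → 16 * N + 22 ≡ 16 * (N + 1) + 6
  16N+22≡16[N+1]+6 = solve-∀

  16N+22≡4[4N+5]+2 : ∀ N → 16 * N + 22 ≡ 4 * (4 * N + 5) + 2
  16N+22≡4[4N+5]+2 = solve-∀

  T2-4N⇒x+y-1≢2[2h-1] : ∀ {N} x y z w h → T2 1 1 8 12 (x , y , z , w) ≡ 4 * N → x + y - 1 ≢ 2 * (2 * h - 1)
  T2-4N⇒x+y-1≢2[2h-1] {N} x y z w h E A≡ with refl ← x+y-1≡t⇒x≡t+1-y x y A≡ | parity y
  ... | even η refl = contradiction (residues-agree 4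
        (- 4 * h * η + 4 * h * h + 3 * w * w + 2 * z * z + 2 * η * η - 3 * h - 3 * w - 2 * z + η) N
        E (lhs h η z w) (sym (ℤ.+-identityʳ (4 * N)))) λ ()
    where
    lhs : ∀ h η z w →
      1 * ((2 * (2 * h - 1) + 1 - 2 * η) * (2 * (2 * h - 1) + 1 - 2 * η - 1)) + 1 * (2 * η * (2 * η - 1)) +
      8 * (z * (z - 1)) + 12 * (w * (w - 1))
      ≡ 4 * (- 4 * h * η + 4 * h * h + 3 * w * w + 2 * z * z + 2 * η * η - 3 * h - 3 * w - 2 * z + η) + 2
    lhs = solve-∀
  ... | odd η refl = contradiction (residues-agree 4
        (- 4 * h * η + 4 * h * h + 3 * w * w + 2 * z * z + 2 * η * η - h - 3 * w - 2 * z - η) N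
        E (lhs h η z w) (sym (ℤ.+-identityʳ (4 * N)))) λ ()
    where
    lhs : ∀ h η z w →
      1 * ((2 * (2 * h - 1) + 1 - (2 * η - 1)) * (2 * (2 * h - 1) + 1 - (2 * η - 1) - 1)) +
      1 * ((2 * η - 1) * (2 * η - 1 - 1)) + 8 * (z * (z - 1)) + 12 * (w * (w - 1))
      ≡ 4 * (- 4 * h * η + 4 * h * h + 3 * w * w + 2 * z * z + 2 * η * η - h - 3 * w - 2 * z - η) + 2
    lhs = solve-∀

  T2-4N⇒x-y≢2[2h-1] : ∀ {N} x y z w h → T2 1 1 8 12 (x , y , z , w) ≡ 4 * N → x - y ≢ 2 * (2 * h - 1)
  T2-4N⇒x-y≢2[2h-1] {N} x y z w h E B≡ with refl ← x≈z//y x (- y) (2 * (2 * h - 1)) B≡ | parity y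
  ... | even η refl = contradiction (residues-agree 4
        (4 * h * η + 4 * h * h + 3 * w * w + 2 * z * z + 2 * η * η - 5 * h - 3 * w - 2 * z - 3 * η + 1) N
        E (lhs h η z w) (sym (ℤ.+-identityʳ (4 * N)))) λ ()
    where
    lhs : ∀ h η z w →
      1 * ((2 * (2 * h - 1) - - (2 * η)) * (2 * (2 * h - 1) - - (2 * η) - 1)) + 1 * (2 * η * (2 * η - 1)) +
      8 * (z * (z - 1)) + 12 * (w * (w - 1))
      ≡ 4 * (4 * h * η + 4 * h * h + 3 * w * w + 2 * z * z + 2 * η * η - 5 * h - 3 * w - 2 * z - 3 * η + 1) + 2
    lhs = solve-∀
  ... | odd η refl = contradiction (residues-agree 4
        (4 * h * η + 4 * h * h + 3 * w * w + 2 * z * z + 2 * η * η - 7 * h - 3 * w - 2 * z - 5 * η + 3) N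
        E (lhs h η z w) (sym (ℤ.+-identityʳ (4 * N)))) λ ()
    where
    lhs : ∀ h η z w →
      1 * ((2 * (2 * h - 1) - - (2 * η - 1)) * (2 * (2 * h - 1) - - (2 * η - 1) - 1)) +
      1 * ((2 * η - 1) * (2 * η - 1 - 1)) + 8 * (z * (z - 1)) + 12 * (w * (w - 1))
      ≡ 4 * (4 * h * η + 4 * h * h + 3 * w * w + 2 * z * z + 2 * η * η - 7 * h - 3 * w - 2 * z - 5 * η + 3) + 2
    lhs = solve-∀

  Q-16N+22⇒x+y-1≢2[2h] : ∀ {N} x y ρ w h → Q 1 1 8 12 (2 * x - 1 , 2 * y - 1 , 2 * ρ , 2 * w - 1) ≡ 16 * N + 22 →
                          x + y - 1 ≢ 2 * (2 * h)
  Q-16N+22⇒x+y-1≢2[2h] {N} x y ρ w h E A≡ with refl ← x+y-1≡t⇒x≡t+1-y x y A≡ | parity y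
  ... | even η refl = contradiction (residues-agree 16
        (- 4 * h * η + 4 * h * h + 3 * w * w + 2 * η * η + 2 * ρ * ρ + h - 3 * w - η) (N + 1)
        E (lhs h η ρ w) (16N+22≡16[N+1]+6 N)) λ ()
    where
    lhs : ∀ h η ρ w →
      1 * ((2 * (2 * (2 * h) + 1 - 2 * η) - 1) * (2 * (2 * (2 * h) + 1 - 2 * η) - 1)) +
      1 * ((2 * (2 * η) - 1) * (2 * (2 * η) - 1)) + 8 * (2 * ρ * (2 * ρ)) + 12 * ((2 * w - 1) * (2 * w - 1))
      ≡ 16 * (- 4 * h * η + 4 * h * h + 3 * w * w + 2 * η * η + 2 * ρ * ρ + h - 3 * w - η) + 14
    lhs = solve-∀
  ... | odd η refl = contradiction (residues-agree 16
        (- 4 * h * η + 4 * h * h + 3 * w * w + 2 * η * η + 2 * ρ * ρ + 3 * h - 3 * w - 3 * η + 1) (N + 1)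
        E (lhs h η ρ w) (16N+22≡16[N+1]+6 N)) λ ()
    where
    lhs : ∀ h η ρ w →
      1 * ((2 * (2 * (2 * h) + 1 - (2 * η - 1)) - 1) * (2 * (2 * (2 * h) + 1 - (2 * η - 1)) - 1)) +
      1 * ((2 * (2 * η - 1) - 1) * (2 * (2 * η - 1) - 1)) + 8 * (2 * ρ * (2 * ρ)) + 12 * ((2 * w - 1) * (2 * w - 1))
      ≡ 16 * (- 4 * h * η + 4 * h * h + 3 * w * w + 2 * η * η + 2 * ρ * ρ + 3 * h - 3 * w - 3 * η + 1) + 14
    lhs = solve-∀

  Q-16N+22⇒x-y≢2[2h] : ∀ {N} x y ρ w h → Q 1 1 8 12 (2 * x - 1 , 2 * y - 1 , 2 * ρ , 2 * w - 1) ≡ 16 * N + 22 →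
                        x - y ≢ 2 * (2 * h)
  Q-16N+22⇒x-y≢2[2h] {N} x y ρ w h E B≡ with refl ← x≈z//y x (- y) (2 * (2 * h)) B≡ | parity y
  ... | even η refl = contradiction (residues-agree 16
        (4 * h * η + 4 * h * h + 3 * w * w + 2 * η * η + 2 * ρ * ρ - h - 3 * w - η) (N + 1)
        E (lhs h η ρ w) (16N+22≡16[N+1]+6 N)) λ ()
    where
    lhs : ∀ h η ρ w →
      1 * ((2 * (2 * (2 * h) - - (2 * η)) - 1) * (2 * (2 * (2 * h) - - (2 * η)) - 1)) +
      1 * ((2 * (2 * η) - 1) * (2 * (2 * η) - 1)) + 8 * (2 * ρ * (2 * ρ)) + 12 * ((2 * w - 1) * (2 * w - 1))
      ≡ 16 * (4 * h * η + 4 * h * h + 3 * w * w + 2 * η * η + 2 * ρ * ρ - h - 3 * w - η) + 14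
    lhs = solve-∀
  ... | odd η refl = contradiction (residues-agree 16
        (4 * h * η + 4 * h * h + 3 * w * w + 2 * η * η + 2 * ρ * ρ - 3 * h - 3 * w - 3 * η + 1) (N + 1)
        E (lhs h η ρ w) (16N+22≡16[N+1]+6 N)) λ ()
    where
    lhs : ∀ h η ρ w →
      1 * ((2 * (2 * (2 * h) - - (2 * η - 1)) - 1) * (2 * (2 * (2 * h) - - (2 * η - 1)) - 1)) +
      1 * ((2 * (2 * η - 1) - 1) * (2 * (2 * η - 1) - 1)) + 8 * (2 * ρ * (2 * ρ)) + 12 * ((2 * w - 1) * (2 * w - 1))
      ≡ 16 * (4 * h * η + 4 * h * h + 3 * w * w + 2 * η * η + 2 * ρ * ρ - 3 * h - 3 * w - 3 * η + 1) + 14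
    lhs = solve-∀

  twist-third-even : ∀ {N} v → T2 1 1 8 12 v ≡ 4 * N → ∃ λ ρ → proj₁ (proj₂ (proj₂ (twist v))) ≡ 2 * ρ
  twist-third-even {N} (x , y , z , w) E with parity (x + y - 1)
  ... | even g A≡2g with parity g
  ...   | even h refl = h , refl
  ...   | odd h refl = ⊥-elim (T2-4N⇒x+y-1≢2[2h-1] {N} x y z w h E A≡2g)
  twist-third-even {N} (x , y , z , w) E | odd g A≡2g-1 with parity (g - y)
  ... | even h g-y≡2h = h , g-y≡2h
  ... | odd h g-y≡2h-1 =
    ⊥-elim (T2-4N⇒x-y≢2[2h-1] {N} x y z w h E (trans (x-y≡2[g-y] x y {g} A≡2g-1) (cong (2 *_) g-y≡2h-1)))

  f₂ : Bool × ℤ⁴ → ℤ⁴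
  f₂ (true , v) = odd⁴ v
  f₂ (false , v) = twist v

  Q-f₂ : ∀ i v → Q 1 1 8 12 (f₂ (i , v)) ≡ 4 * T2 1 1 8 12 v + 22
  Q-f₂ true v = Q-odd⁴ 1 1 8 12 v
  Q-f₂ false v = Q-twist v

  f₂-injective : ∀ {N i j v v′} → T2 1 1 8 12 v ≡ 4 * N → T2 1 1 8 12 v′ ≡ 4 * N →
                 f₂ (i , v) ≡ f₂ (j , v′) → (i , v) ≡ (j , v′)
  f₂-injective {i = true} {true} _ _ eq = cong (true ,_) (odd⁴-injective eq)
  f₂-injective {i = false} {false} _ _ eq = cong (false ,_) (twist-injective eq)
  f₂-injective {i = true} {false} {_ , _ , z , _} {v′} _ E′ eq
    with ρ , third≡2ρ ← twist-third-even v′ E′ =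
    ⊥-elim (2x-1≢2y z ρ (trans (cong (proj₁ ∘ proj₂ ∘ proj₂) eq) third≡2ρ))
  f₂-injective {i = false} {true} {v} {_ , _ , z′ , _} E _ eq
    with ρ , third≡2ρ ← twist-third-even v E =
    ⊥-elim (2x-1≢2y z′ ρ (trans (sym (cong (proj₁ ∘ proj₂ ∘ proj₂) eq)) third≡2ρ))

  twist-preimage-even : ∀ N x y ρ w {g} → x + y - 1 ≡ 2 * g →
    Q 1 1 8 12 (2 * x - 1 , 2 * y - 1 , 2 * ρ , 2 * w - 1) ≡ 16 * N + 22 →
    ∃ λ v → twist v ≡ (2 * x - 1 , 2 * y - 1 , 2 * ρ , 2 * w - 1)
  twist-preimage-even N x y ρ w {g} A≡2g E with parity g
  ... | even h refl = ⊥-elim (Q-16N+22⇒x+y-1≢2[2h] {N} x y ρ w h E A≡2g)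
  ... | odd ζ refl with refl ← x+y-1≡t⇒x≡t+1-y x y A≡2g =
    (2 * ρ + 2 * ζ - y , 2 * ρ - 2 * ζ + y + 1 , ζ , w) ,
    trans (twist-even (2 * ρ + 2 * ζ - y) (2 * ρ - 2 * ζ + y + 1) ζ w (A′≡ ρ ζ y))
          (quadruple-≡ (p≡ ρ ζ y) (q≡ ρ ζ y) refl refl)
    where
    A′≡ : ∀ ρ ζ y → 2 * ρ + 2 * ζ - y + (2 * ρ - 2 * ζ + y + 1) - 1 ≡ 2 * (2 * ρ)
    A′≡ = solve-∀
    p≡ : ∀ ρ ζ y → 2 * (2 * ζ - 1) + (2 * ρ + 2 * ζ - y - (2 * ρ - 2 * ζ + y + 1))
                   ≡ 2 * (2 * (2 * ζ - 1) + 1 - y) - 1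
    p≡ = solve-∀
    q≡ : ∀ ρ ζ y → 2 * (2 * ζ - 1) - (2 * ρ + 2 * ζ - y - (2 * ρ - 2 * ζ + y + 1)) ≡ 2 * y - 1
    q≡ = solve-∀

  twist-preimage-odd : ∀ N x y ρ w {g} → x + y - 1 ≡ 2 * g - 1 →
    Q 1 1 8 12 (2 * x - 1 , 2 * y - 1 , 2 * ρ , 2 * w - 1) ≡ 16 * N + 22 →
    ∃ λ v → twist v ≡ (2 * x - 1 , 2 * y - 1 , 2 * ρ , 2 * w - 1)
  twist-preimage-odd N x y ρ w {g} A≡2g-1 E with parity (g - y)
  ... | even h g-y≡2h =
    ⊥-elim (Q-16N+22⇒x-y≢2[2h] {N} x y ρ w h E (trans (x-y≡2[g-y] x y {g} A≡2g-1) (cong (2 *_) g-y≡2h)))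
  ... | odd ζ g-y≡2ζ-1
    with refl ← x+y-1≡t⇒x≡t+1-y x y A≡2g-1 | refl ← x≈z//y g (- y) (2 * ζ - 1) g-y≡2ζ-1 =
    (G + 2 * ρ , G - 2 * ρ , ζ , w) ,
    trans (twist-odd (G + 2 * ρ) (G - 2 * ρ) ζ w {G} (A′≡ G ρ))
          (quadruple-≡ (p≡ ζ y ρ) (q≡ ζ y ρ) (r≡ G ρ) refl)
    where
    G = 2 * ζ - 1 - - y
    A′≡ : ∀ G ρ → G + 2 * ρ + (G - 2 * ρ) - 1 ≡ 2 * G - 1
    A′≡ = solve-∀
    p≡ : ∀ ζ y ρ → let G = 2 * ζ - 1 - - y in
         G + 2 * ρ + (G - 2 * ρ) - 1 + 2 * (2 * ζ - 1) ≡ 2 * (2 * G - 1 + 1 - y) - 1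
    p≡ = solve-∀
    q≡ : ∀ ζ y ρ → let G = 2 * ζ - 1 - - y in
         G + 2 * ρ + (G - 2 * ρ) - 1 - 2 * (2 * ζ - 1) ≡ 2 * y - 1
    q≡ = solve-∀
    r≡ : ∀ G ρ → G - (G - 2 * ρ) ≡ 2 * ρ
    r≡ = solve-∀

  Q-16N+22⇒p,q,s-odd : ∀ {N} p q r s → Q 1 1 8 12 (p , q , r , s) ≡ 16 * N + 22 →
                        ∃ λ x → ∃ λ y → ∃ λ w → p ≡ 2 * x - 1 × q ≡ 2 * y - 1 × s ≡ 2 * w - 1
  Q-16N+22⇒p,q,s-odd {N} p q r s E with parity p | parity q
  ... | even a refl | even b refl = contradiction
    (residues-agree 4 (a * a + b * b + 2 * r * r + 3 * s * s) (4 * N + 5) E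
      (lhs a b r s) (16N+22≡4[4N+5]+2 N)) λ ()
    where
    lhs : ∀ a b r s → 1 * (2 * a * (2 * a)) + 1 * (2 * b * (2 * b)) + 8 * (r * r) + 12 * (s * s)
                      ≡ 4 * (a * a + b * b + 2 * r * r + 3 * s * s) + 0
    lhs = solve-∀
  ... | odd a refl | even b refl = contradiction
    (residues-agree 4 (a * a + b * b + 2 * r * r + 3 * s * s - a) (4 * N + 5) E
      (lhs a b r s) (16N+22≡4[4N+5]+2 N)) λ ()
    where
    lhs : ∀ a b r s → 1 * ((2 * a - 1) * (2 * a - 1)) + 1 * (2 * b * (2 * b)) + 8 * (r * r) + 12 * (s * s)
                      ≡ 4 * (a * a + b * b + 2 * r * r + 3 * s * s - a) + 1
    lhs = solve-∀
  ... | even a refl | odd b refl = contradiction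
    (residues-agree 4 (a * a + b * b + 2 * r * r + 3 * s * s - b) (4 * N + 5) E
      (lhs a b r s) (16N+22≡4[4N+5]+2 N)) λ ()
    where
    lhs : ∀ a b r s → 1 * (2 * a * (2 * a)) + 1 * ((2 * b - 1) * (2 * b - 1)) + 8 * (r * r) + 12 * (s * s)
                      ≡ 4 * (a * a + b * b + 2 * r * r + 3 * s * s - b) + 1
    lhs = solve-∀
  ... | odd x refl | odd y refl with parity s
  ...   | odd w refl = x , y , w , refl , refl , refl
  ...   | even k refl with m₁ , x² ← odd-square x | m₂ , y² ← odd-square y = contradiction
    (residues-agree 8 (6 * k * k + r * r + m₁ + m₂) (2 * N + 2) E
      (trans (form-cong 1 1 8 12 x² y² refl refl) (lhs m₁ m₂ r k)) (rhs N)) λ ()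
    where
    lhs : ∀ m₁ m₂ r k → 1 * (8 * m₁ + 1) + 1 * (8 * m₂ + 1) + 8 * (r * r) + 12 * (2 * k * (2 * k))
                        ≡ 8 * (6 * k * k + r * r + m₁ + m₂) + 2
    lhs = solve-∀
    rhs : ∀ N → 16 * N + 22 ≡ 8 * (2 * N + 2) + 6
    rhs = solve-∀

  f₂-surjective : ∀ {N u} → Q 1 1 8 12 u ≡ 16 * N + 22 → ∃ λ iv → f₂ iv ≡ u
  f₂-surjective {N} {p , q , r , s} E
    with x , y , w , refl , refl , refl ← Q-16N+22⇒p,q,s-odd {N} p q r s E | parity r
  ... | odd z refl = (true , x , y , z , w) , refl
  ... | even ρ refl with parity (x + y - 1)
  ...   | even g A≡2g with v , twist-v≡u ← twist-preimage-even N x y ρ w {g} A≡2g E =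
    (false , v) , twist-v≡u
  ...   | odd g A≡2g-1 with v , twist-v≡u ← twist-preimage-odd N x y ρ w {g} A≡2g-1 E =
    (false , v) , twist-v≡u

  2t[1,1,8,12]≡N[1,1,8,12] : ∀ n → 2 ℕ.* t 1 1 8 12 (2 ℕ.* n) ≡ N 1 1 8 12 (16 ℕ.* n ℕ.+ 22)
  2t[1,1,8,12]≡N[1,1,8,12] n = subst (λ M → 2 ℕ.* t 1 1 8 12 (2 ℕ.* n) ≡ N 1 1 8 12 (M ℕ.+ 22))
    (sym (ℕ.*-assoc 8 2 n))
    (2t≡N 1 1 8 12 1 1 8 12 (2 ℕ.* n) 22 f₂ Q-f₂
      (λ E E′ → f₂-injective {+ n} (trans E 2[2n]≡4n) (trans E′ 2[2n]≡4n))
      (λ E → f₂-surjective {+ n} (trans E 8[2n]+22≡16n+22)))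
    where
    2[2n]≡4n : 2 * + (2 ℕ.* n) ≡ 4 * + n
    2[2n]≡4n = trans (cong (2 *_) (ℤ.pos-* 2 n)) (solve (+ n))
      where
      solve : ∀ n → 2 * (2 * n) ≡ 4 * n
      solve = solve-∀
    8[2n]+22≡16n+22 : 8 * + (2 ℕ.* n) + + 22 ≡ 16 * + n + 22
    8[2n]+22≡16n+22 = trans (cong (λ t → 8 * t + 22) (ℤ.pos-* 2 n)) (solve (+ n))
      where
      solve : ∀ n → 8 * (2 * n) + 22 ≡ 16 * n + 22
      solve = solve-∀

open import Data.Nat using (ℕ; suc; _+_; _*_)
open import Data.Product using (_×_; _,_)
open import Relation.Binary.PropositionalEquality using (_≡_)

theorem2p13 : (n : ℕ) → 1 Data.Nat.≤ n →
    (2 * t 1 2 2 6 n ≡ N 1 1 4 6 (8 * n + 11))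
    × (2 * t 1 1 8 12 (2 * n) ≡ N 1 1 8 12 (16 * n + 22))
theorem2p13 n _ = 2t[1,2,2,6]≡N[1,1,4,6] n , 2t[1,1,8,12]≡N[1,1,8,12] n
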